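{- Let $q\in\mathbb{Z}\setminus\{0\}$ and $w_r=w_r(0,1,q)$, i.e. $w_0=0$, $w_1=1$, $w_r=qw_{r-1}+w_{r-2}$. For $n\ge1$, the sequence $(w_r)$ modulo $7^n$ is residue complete if and only if $n=1$ and $q\equiv1,3,4,6\pmod 7$.
   Context: A sequence is residue complete modulo $m$ if every residue class of $\mathbb{Z}_m$ occurs among its terms modulo $m$. -}

module Defs where

open import Data.Nat using (ℕ; zero; suc)
open import Data.Integer using (ℤ; +_; _+_; _*_; _-_)
open import Data.Integer.Divisibility using (_∣_)
open import Data.Product using (∃)

w : ℤ → ℕ → ℤ
w q zero = + 0
w q (suc zero) = + 1
w q (suc (suc r)) = q * w q (suc r) + w q r

_≡_[mod_] : ℤ → ℤ → ℕ → Set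
a ≡ b [mod m ] = (+ m) ∣ (a - b)

ResidueComplete : (ℕ → ℤ) → ℕ → Set
ResidueComplete s m = ∀ (a : ℤ) → ∃ λ r → s r ≡ a [mod m ]

-- The pair (w r, w (r+1)) reduced mod m evolves under a map of (ℤ/m)² that depends only on
-- q mod m, so residue completeness mod m is a property of the class of q. Each such orbit is
-- purely periodic with period dividing 336, so completeness is decided by inspecting one period
-- per class: mod 7 exactly the classes 1, 3, 4, 6 reach every residue, and mod 49 no class does.
-- Completeness mod 7ⁿ descends to every divisor of 7ⁿ, which rules out n ≥ 2.
module Submission where

open import Defs
open import Data.Nat using (ℕ; _≥_; _^_)
open import Data.Integer using (ℤ; +_)
open import Data.Product using (_×_)
open import Data.Sum using (_⊎_)
open import Relation.Binary.PropositionalEquality using (_≡_; _≢_)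
open import Function.Bundles using (_⇔_)

open import Data.Nat as ℕ using (zero; suc; NonZero; _<_; _%_)
import Data.Nat.Properties as ℕₚ
import Data.Nat.Divisibility as ℕ∣
open import Data.Nat.DivMod using (m%n<n)
open import Data.Nat.GeneralisedArithmetic using (iterate)
open import Data.Integer using (_+_; _*_; _-_; -_; ∣_∣; _/ℕ_; _%ℕ_)
import Data.Integer.Properties as ℤₚ
open import Data.Integer.DivMod using (n%ℕd<d; a≡a%ℕn+[a/ℕn]*n)
import Data.Integer.Divisibility.Signed as Signed
open import Data.Integer.Tactic.RingSolver using (solve-∀)
open import Data.List as List using (List; map)
open import Data.List.Relation.Unary.Any using (here; there)
open import Data.List.Membership.Propositional using (_∈_)
open import Data.List.Membership.Propositional.Properties using (∈-map⁺; ∈-map⁻)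
open import Data.List.Membership.DecPropositional ℕₚ._≟_ using (_∈?_)
open import Data.Product using (∃; _,_; proj₁; proj₂)
open import Data.Product.Properties using (≡-dec)
open import Data.Sum as Sum using (inj₁; inj₂; [_,_]′)
open import Data.Sum.Function.Propositional using (_⊎-⇔_)
open import Function using (id)
open import Function.Bundles using (mk⇔; Equivalence)
import Function.Properties.Equivalence as ⇔
open import Relation.Nullary using (Dec; ¬_; contradiction)
open import Relation.Nullary.Decidable using (from-yes; ¬?; _⊎-dec_; _×-dec_; _→-dec_)
open import Relation.Binary.PropositionalEquality using (refl; sym; trans; cong; subst; module ≡-Reasoning)

-- A record rather than the bare divisibility, so that a, b and m can be inferred from a proof.
infix 4 _≈_[mod_]
record _≈_[mod_] (a b : ℤ) (m : ℕ) : Set where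
  constructor mk≈
  field divides-difference : + m Signed.∣ a - b

≈⇒≡[mod] : ∀ {a b m} → a ≈ b [mod m ] → a ≡ b [mod m ]
≈⇒≡[mod] (mk≈ m∣a-b) = Signed.∣⇒∣ᵤ m∣a-b

≡[mod]⇒≈ : ∀ {a b m} → a ≡ b [mod m ] → a ≈ b [mod m ]
≡[mod]⇒≈ m∣a-b = mk≈ (Signed.∣ᵤ⇒∣ m∣a-b)

≈-reflexive : ∀ {a b m} → a ≡ b → a ≈ b [mod m ]
≈-reflexive {a} {m = m} refl =
  mk≈ (Signed.divides (+ 0) (trans (ℤₚ.+-inverseʳ a) (sym (ℤₚ.*-zeroˡ (+ m)))))

≈-sym : ∀ {a b m} → a ≈ b [mod m ] → b ≈ a [mod m ]
≈-sym {a} {b} (mk≈ m∣a-b) = mk≈ (subst (_ Signed.∣_) (negate a b) (Signed.∣m⇒∣-m m∣a-b))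
  where
  negate : ∀ a b → - (a - b) ≡ b - a
  negate = solve-∀

≈-trans : ∀ {a b c m} → a ≈ b [mod m ] → b ≈ c [mod m ] → a ≈ c [mod m ]
≈-trans {a} {b} {c} (mk≈ m∣a-b) (mk≈ m∣b-c) =
  mk≈ (subst (_ Signed.∣_) (telescope a b c) (Signed.∣m∣n⇒∣m+n m∣a-b m∣b-c))
  where
  telescope : ∀ a b c → (a - b) + (b - c) ≡ a - c
  telescope = solve-∀

+-cong-≈ : ∀ {a b c d m} → a ≈ b [mod m ] → c ≈ d [mod m ] → a + c ≈ b + d [mod m ]
+-cong-≈ {a} {b} {c} {d} (mk≈ m∣a-b) (mk≈ m∣c-d) =
  mk≈ (subst (_ Signed.∣_) (regroup a b c d) (Signed.∣m∣n⇒∣m+n m∣a-b m∣c-d))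
  where
  regroup : ∀ a b c d → (a - b) + (c - d) ≡ (a + c) - (b + d)
  regroup = solve-∀

*-cong-≈ : ∀ {a b c d m} → a ≈ b [mod m ] → c ≈ d [mod m ] → a * c ≈ b * d [mod m ]
*-cong-≈ {a} {b} {c} {d} (mk≈ m∣a-b) (mk≈ m∣c-d) =
  mk≈ (subst (_ Signed.∣_) (regroup a b c d)
        (Signed.∣m∣n⇒∣m+n (Signed.∣m⇒∣m*n c m∣a-b) (Signed.∣n⇒∣m*n b m∣c-d)))
  where
  regroup : ∀ a b c d → (a - b) * c + b * (c - d) ≡ a * c - b * d
  regroup = solve-∀

≈-%ℕ : ∀ a m .{{_ : NonZero m}} → a ≈ + (a %ℕ m) [mod m ]
≈-%ℕ a m = mk≈ (Signed.divides (a /ℕ m) (begin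
  a - + r                     ≡⟨ cong (_- + r) (a≡a%ℕn+[a/ℕn]*n a m) ⟩
  + r + (a /ℕ m) * + m - + r  ≡⟨ cancel (+ r) (a /ℕ m) (+ m) ⟩
  (a /ℕ m) * + m              ∎))
  where
  open ≡-Reasoning
  r = a %ℕ m
  cancel : ∀ r k m → r + k * m - r ≡ k * m
  cancel = solve-∀

∣∧<⇒≡0 : ∀ {m n} → m ℕ∣.∣ n → n < m → n ≡ 0
∣∧<⇒≡0 {n = zero}  _   _   = refl
∣∧<⇒≡0 {n = suc _} m∣n n<m = contradiction m∣n (ℕ∣.>⇒∤ n<m)

≈-below⇒≡ : ∀ {m x y} → x < m → y < m → + x ≈ + y [mod m ] → x ≡ y
≈-below⇒≡ {m} {x} {y} x<m y<m (mk≈ m∣x-y) =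
  ℤₚ.+-injective (ℤₚ.i-j≡0⇒i≡j _ _ (ℤₚ.∣i∣≡0⇒i≡0 (∣∧<⇒≡0 (Signed.∣⇒∣ᵤ m∣x-y) distance<m)))
  where
  distance<m : ∣ + x - + y ∣ < m
  distance<m = subst (_< m) (cong ∣_∣ (sym (ℤₚ.[+m]-[+n]≡m⊖n x y)))
                 (ℕₚ.≤-<-trans (ℤₚ.∣m⊝n∣≤m⊔n x y) (ℕₚ.⊔-lub x<m y<m))

≡[mod]⇔%ℕ≡ : ∀ {q c m} .{{_ : NonZero m}} → c < m → q ≡ + c [mod m ] ⇔ q %ℕ m ≡ c
≡[mod]⇔%ℕ≡ {q} {m = m} c<m = mk⇔
  (λ q≡c → ≈-below⇒≡ (n%ℕd<d q m) c<m (≈-trans (≈-sym (≈-%ℕ q m)) (≡[mod]⇒≈ q≡c)))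
  (λ q%m≡c → ≈⇒≡[mod] (subst (λ t → q ≈ + t [mod m ]) q%m≡c (≈-%ℕ q m)))

ResidueComplete-∣ : ∀ {s m n} → m ℕ∣.∣ n → ResidueComplete s n → ResidueComplete s m
ResidueComplete-∣ m∣n complete a = let r , n∣sᵣ-a = complete a in r , ℕ∣.∣-trans m∣n n∣sᵣ-a

module _ {A : Set} (f : A → A) where

  iterate-suc : ∀ x n → iterate f x (suc n) ≡ f (iterate f x n)
  iterate-suc x zero    = refl
  iterate-suc x (suc n) = iterate-suc (f x) n

  iterate-preserves : {P : A → Set} → (∀ {y} → P y → P (f y)) → ∀ {x} → P x → ∀ n → P (iterate f x n)
  iterate-preserves     f-pres Px zero    = Px
  iterate-preserves {P} f-pres Px (suc n) = iterate-preserves {P} f-pres (f-pres Px) n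

  ∈-iterate⁻ : ∀ {x y} n → y ∈ List.iterate f x n → ∃ λ j → iterate f x j ≡ y
  ∈-iterate⁻ (suc n) (here refl) = 0 , refl
  ∈-iterate⁻ (suc n) (there y∈) = let j , fʲ⁺¹x≡y = ∈-iterate⁻ n y∈ in suc j , fʲ⁺¹x≡y

  ∈-iterate-step : ∀ {x y} k → y ∈ List.iterate f x (suc k) →
                   f y ∈ List.iterate f x (suc k) ⊎ f y ≡ iterate f x (suc k)
  ∈-iterate-step zero    (here refl)  = inj₂ refl
  ∈-iterate-step zero    (there ())
  ∈-iterate-step (suc k) (here refl)  = inj₁ (there (here refl))
  ∈-iterate-step (suc k) (there y∈)   = Sum.map₁ there (∈-iterate-step k y∈)

  periodic-iterate-∈ : ∀ {x} k → iterate f x (suc k) ≡ x → ∀ r → iterate f x r ∈ List.iterate f x (suc k)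
  periodic-iterate-∈     k period zero    = here refl
  periodic-iterate-∈ {x} k period (suc r) =
    subst (_∈ List.iterate f x (suc k)) (sym (iterate-suc x r))
      ([ id , (λ f[fʳx]≡fᵏ⁺¹x → here (trans f[fʳx]≡fᵏ⁺¹x period)) ]′
        (∈-iterate-step k (periodic-iterate-∈ k period r)))

module Reduced (m : ℕ) .{{_ : NonZero m}} (c : ℕ) where

  step : ℕ × ℕ → ℕ × ℕ
  step (x , y) = y , (c ℕ.* y ℕ.+ x) % m

  start : ℕ × ℕ
  start = 0 , 1 % m

  state : ℕ → ℕ × ℕ
  state = iterate step start

  returns? : ∀ k → Dec (state k ≡ start)
  returns? k = ≡-dec ℕₚ._≟_ ℕₚ._≟_ (state k) start

  residuesWithin : ℕ → List ℕ
  residuesWithin k = map proj₁ (List.iterate step start k)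

  Complete : ℕ → Set
  Complete k = ∀ {a} → a < m → a ∈ residuesWithin k

  complete? : ∀ k → Dec (Complete k)
  complete? k = ℕₚ.allUpTo? (_∈? residuesWithin k) m

  InRange : ℕ × ℕ → Set
  InRange (x , y) = x < m × y < m

  state-inRange : ∀ r → InRange (state r)
  state-inRange = iterate-preserves step {InRange} (λ (_ , y<m) → y<m , m%n<n _ m)
                    (ℕ.>-nonZero⁻¹ m , m%n<n 1 m)

  w≈state : ∀ {q} → q ≈ + c [mod m ] → ∀ r →
            w q r ≈ + proj₁ (state r) [mod m ] × w q (suc r) ≈ + proj₂ (state r) [mod m ]
  w≈state q≈c zero = ≈-reflexive refl , ≈-%ℕ (+ 1) m
  w≈state {q} q≈c (suc r) = subst Tracks (sym (iterate-suc step start r)) (wᵣ₊₁≈y , wᵣ₊₂≈next)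
    where
    Tracks : ℕ × ℕ → Set
    Tracks s = w q (suc r) ≈ + proj₁ s [mod m ] × w q (suc (suc r)) ≈ + proj₂ s [mod m ]
    x = proj₁ (state r)
    y = proj₂ (state r)
    wᵣ≈x = proj₁ (w≈state q≈c r)
    wᵣ₊₁≈y = proj₂ (w≈state q≈c r)
    cast : + c * + y + + x ≡ + (c ℕ.* y ℕ.+ x)
    cast = sym (trans (ℤₚ.pos-+ (c ℕ.* y) x) (cong (_+ + x) (ℤₚ.pos-* c y)))
    wᵣ₊₂≈next : w q (suc (suc r)) ≈ + ((c ℕ.* y ℕ.+ x) % m) [mod m ]
    wᵣ₊₂≈next = ≈-trans (+-cong-≈ (*-cong-≈ q≈c wᵣ₊₁≈y) wᵣ≈x)
                  (subst (λ z → z ≈ + ((c ℕ.* y ℕ.+ x) % m) [mod m ]) (sym cast)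
                    (≈-%ℕ (+ (c ℕ.* y ℕ.+ x)) m))

  residueComplete⇔ : ∀ {q} k → q ≈ + c [mod m ] → state (suc k) ≡ start →
                     ResidueComplete (w q) m ⇔ Complete (suc k)
  residueComplete⇔ {q} k q≈c period = mk⇔ complete⇒ ⇒complete
    where
    complete⇒ : ResidueComplete (w q) m → Complete (suc k)
    complete⇒ rc {a} a<m = subst (_∈ residuesWithin (suc k)) stateᵣ≡a
                             (∈-map⁺ proj₁ (periodic-iterate-∈ step k period r))
      where
      r = proj₁ (rc (+ a))
      stateᵣ≡a : proj₁ (state r) ≡ a
      stateᵣ≡a = ≈-below⇒≡ (proj₁ (state-inRange r)) a<m
                   (≈-trans (≈-sym (proj₁ (w≈state q≈c r))) (≡[mod]⇒≈ (proj₂ (rc (+ a)))))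
    ⇒complete : Complete (suc k) → ResidueComplete (w q) m
    ⇒complete complete a = j , ≈⇒≡[mod] (≈-trans (proj₁ (w≈state q≈c j))
                                 (≈-trans (≈-reflexive (cong +_ stateⱼ≡a%m)) (≈-sym (≈-%ℕ a m))))
      where
      residue-hit = ∈-map⁻ proj₁ (complete (n%ℕd<d a m))
      orbit-hit = ∈-iterate⁻ step (suc k) (proj₁ (proj₂ residue-hit))
      j = proj₁ orbit-hit
      stateⱼ≡a%m : proj₁ (state j) ≡ a %ℕ m
      stateⱼ≡a%m = trans (cong proj₁ (proj₂ orbit-hit)) (sym (proj₂ (proj₂ residue-hit)))

residueComplete⇔complete : ∀ m .{{_ : NonZero m}} k →
  (∀ {c} → c < m → Reduced.state m c (suc k) ≡ Reduced.start m c) →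
  ∀ q → ResidueComplete (w q) m ⇔ Reduced.Complete m (q %ℕ m) (suc k)
residueComplete⇔complete m k periodic q =
  Reduced.residueComplete⇔ m (q %ℕ m) k (≈-%ℕ q m) (periodic (n%ℕd<d q m))

-- 336 = 7 · 48: x² − cx − 1 never has a double root mod 7 (3 is not a square mod 7), so the
-- matrix of the step has order dividing 48 mod 7, and lifting to 49 multiplies it by at most 7.
periodic-mod7 : ∀ {c} → c < 7 → Reduced.state 7 c 336 ≡ Reduced.start 7 c
periodic-mod7 = from-yes (ℕₚ.allUpTo? (λ c → Reduced.returns? 7 c 336) 7)

periodic-mod49 : ∀ {c} → c < 49 → Reduced.state 49 c 336 ≡ Reduced.start 49 c
periodic-mod49 = from-yes (ℕₚ.allUpTo? (λ c → Reduced.returns? 49 c 336) 49)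

incomplete-mod49 : ∀ {c} → c < 49 → ¬ Reduced.Complete 49 c 336
incomplete-mod49 = from-yes (ℕₚ.allUpTo? (λ c → ¬? (Reduced.complete? 49 c 336)) 49)

GoodResidue : ℕ → Set
GoodResidue c = c ≡ 1 ⊎ c ≡ 3 ⊎ c ≡ 4 ⊎ c ≡ 6

goodResidue? : ∀ c → Dec (GoodResidue c)
goodResidue? c = c ℕₚ.≟ 1 ⊎-dec c ℕₚ.≟ 3 ⊎-dec c ℕₚ.≟ 4 ⊎-dec c ℕₚ.≟ 6

complete-mod7⇔goodResidue : ∀ {c} → c < 7 → Reduced.Complete 7 c 336 ⇔ GoodResidue c
complete-mod7⇔goodResidue c<7 = let complete⇒good , good⇒complete = decided c<7 in
  mk⇔ complete⇒good good⇒complete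
  where
  decided = from-yes (ℕₚ.allUpTo? (λ c → let complete? = Reduced.complete? 7 c 336 in
                        (complete? →-dec goodResidue? c) ×-dec (goodResidue? c →-dec complete?)) 7)

Good : ℤ → Set
Good q = q ≡ + 1 [mod 7 ] ⊎ q ≡ + 3 [mod 7 ] ⊎ q ≡ + 4 [mod 7 ] ⊎ q ≡ + 6 [mod 7 ]

good⇔goodResidue : ∀ q → Good q ⇔ GoodResidue (q %ℕ 7)
good⇔goodResidue q =
  class (from-yes (1 ℕₚ.<? 7)) ⊎-⇔ class (from-yes (3 ℕₚ.<? 7)) ⊎-⇔
  class (from-yes (4 ℕₚ.<? 7)) ⊎-⇔ class (from-yes (6 ℕₚ.<? 7))
  where
  class : ∀ {c} → c < 7 → q ≡ + c [mod 7 ] ⇔ q %ℕ 7 ≡ c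
  class = ≡[mod]⇔%ℕ≡ {q}

residueComplete-mod7⇔good : ∀ q → ResidueComplete (w q) 7 ⇔ Good q
residueComplete-mod7⇔good q =
  ⇔.trans (residueComplete⇔complete 7 335 periodic-mod7 q)
    (⇔.trans (complete-mod7⇔goodResidue (n%ℕd<d q 7)) (⇔.sym (good⇔goodResidue q)))

residueIncomplete-mod49 : ∀ q → ¬ ResidueComplete (w q) 49
residueIncomplete-mod49 q complete = incomplete-mod49 (n%ℕd<d q 49)
  (Equivalence.to (residueComplete⇔complete 49 335 periodic-mod49 q) complete)

49∣7^[2+n] : ∀ n → 49 ℕ∣.∣ 7 ^ (2 ℕ.+ n)
49∣7^[2+n] n = ℕ∣.*-monoʳ-∣ 7 (ℕ∣.m∣m*n {7} (7 ^ n))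

lemma4p4 : (q : ℤ) → q ≢ + 0 → (n : ℕ) → n ≥ 1 →
    ResidueComplete (w q) (7 ^ n) ⇔
      (n ≡ 1 × (q ≡ + 1 [mod 7 ] ⊎ q ≡ + 3 [mod 7 ] ⊎ q ≡ + 4 [mod 7 ] ⊎ q ≡ + 6 [mod 7 ]))
lemma4p4 q _ zero ()
lemma4p4 q _ (suc zero) _ = ⇔.trans (residueComplete-mod7⇔good q) (mk⇔ (refl ,_) proj₂)
lemma4p4 q _ (suc (suc n)) _ = mk⇔
  (λ complete → contradiction (ResidueComplete-∣ {w q} (49∣7^[2+n] n) complete)
                              (residueIncomplete-mod49 q))
  (λ ())
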